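{- There is a constant $C$ such that for all $n\ge 1$, $\left|\chi_{\mathrm{gp}}(P_3\square P_n)-\frac{5n}{6}\right|\le C$. Moreover, if $12\mid n$, then $\chi_{\mathrm{gp}}(P_3\square P_n)=\frac{5n}{6}$.
   Context: $P_m$ is the path on $m$ vertices; $G\square H$ is the Cartesian product. A set is in general position if no shortest path contains more than two of its vertices; $\chi_{\mathrm{gp}}(G)$ is the minimum number of colours in a colouring of $V(G)$ with each colour class in general position. -}

module Defs where

open import Data.Nat using (ℕ; zero; suc; _+_; _*_; _≤_; _<_)
open import Data.Fin using (Fin; toℕ)
open import Data.Product using (_×_; _,_; Σ)
open import Data.Sum using (_⊎_)
open import Data.Empty using (⊥)
open import Relation.Binary.PropositionalEquality using (_≡_)
open import Relation.Nullary using (¬_)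

record Graph : Set₁ where
  field
    V   : Set
    Adj : V → V → Set
open Graph public

P : ℕ → Graph
V   (P m) = Fin m
Adj (P m) i j = (suc (toℕ i) ≡ toℕ j) ⊎ (suc (toℕ j) ≡ toℕ i)

_□_ : Graph → Graph → Graph
V   (G □ H) = V G × V H
Adj (G □ H) (g , h) (g' , h') = (g ≡ g' × Adj H h h') ⊎ (h ≡ h' × Adj G g g')

data Walk (G : Graph) : V G → V G → Set where
  [_]   : (x : V G) → Walk G x x
  _∷⟨_⟩_ : (x : V G) {y z : V G} → Adj G x y → Walk G y z → Walk G x z

len : ∀ {G u v} → Walk G u v → ℕ
len [ x ] = zero
len (x ∷⟨ e ⟩ w) = suc (len w)

data _∈W_ {G : Graph} (a : V G) : ∀ {u v} → Walk G u v → Set where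
  here₀ : a ∈W [ a ]
  here  : ∀ {y z} (e : Adj G a y) (w : Walk G y z) → a ∈W (a ∷⟨ e ⟩ w)
  there : ∀ {x y z} (e : Adj G x y) {w : Walk G y z} → a ∈W w → a ∈W (x ∷⟨ e ⟩ w)

-- A shortest path: a u–v walk of minimum length among all u–v walks
-- (such a walk has no repeated vertices, hence is a path).
IsShortest : ∀ {G u v} → Walk G u v → Set
IsShortest {G} {u} {v} p = (q : Walk G u v) → len p ≤ len q

InGeneralPosition : (G : Graph) → (V G → Set) → Set
InGeneralPosition G S =
  ∀ {u v} (p : Walk G u v) → IsShortest p →
  ∀ x y z → S x → S y → S z →
  ¬ x ≡ y → ¬ x ≡ z → ¬ y ≡ z →
  x ∈W p → y ∈W p → z ∈W p → ⊥

IsGPColouring : (G : Graph) (k : ℕ) → (V G → Fin k) → Set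
IsGPColouring G k c = (i : Fin k) → InGeneralPosition G (λ x → c x ≡ i)

ChiGP≡ : Graph → ℕ → Set
ChiGP≡ G k =
  (Σ (V G → Fin k) (IsGPColouring G k)) ×
  (∀ m → m < k → (c : V G → Fin m) → ¬ IsGPColouring G m c)

module Submission where

-- In a grid Pₘ □ Pₙ the shortest-path distance is the ℓ¹ distance, and a set
-- is in general position exactly when no three of its points x, y, z satisfy
-- d(x,y) + d(y,z) = d(x,z).
--
-- Lower bound: weight the outer rows of P₃ □ Pₙ by 2 and the middle row by 1.
-- A set in general position has at most two points in each row, cannot have
-- two points in both outer rows, and cannot have two points in an outer row
-- together with points in both other rows; so it weighs at most 6, while the
-- whole grid weighs 5n.  Hence 6 χ ≥ 5n.
--
-- Upper bound: a 10-colouring of P₃ □ P₁₂ in general position, repeated on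
-- consecutive blocks of 12 columns with disjoint palettes, stays in general
-- position, because a monochromatic triple lies in one block, where distances
-- are those of the tile.  This uses 10 ⌈n/12⌉ colours.

open import Defs
open import Data.Nat using (ℕ; zero; suc; _+_; _*_; _∸_; _≤_; _<_; ∣_-_∣; z≤n; s≤s; _≤?_)
open import Data.Nat.Properties hiding (_≟_)
open import Data.Fin using (Fin; toℕ; fromℕ<; #_; inject≤; combine; remQuot)
import Data.Fin as Fin
import Data.Nat as ℕ
open import Data.Fin.Properties
  using (_≟_; toℕ-injective; toℕ-fromℕ<; toℕ<n; toℕ-inject≤; toℕ-combine; combine-remQuot; remQuot-combine; all?)
open import Data.Fin.Patterns using (0F; 1F; 2F)
open import Data.Product using (Σ; ∃; ∃₂; ∃-syntax; _×_; _,_; proj₁; proj₂)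
open import Data.Product.Properties using (,-injectiveˡ; ,-injectiveʳ; ≡-dec)
open import Data.Vec using (Vec; []; _∷_; lookup)
open import Data.Nat.DivMod using (_/_; m≡m%n+[m/n]*n; m%n<n; m/n*n≤m)
open import Data.Nat.Divisibility using (_∣_; divides)
open import Data.Sum using (_⊎_; inj₁; inj₂)
open import Data.Empty using (⊥)
open import Function using (_∘_; _$_)
open import Relation.Nullary using (¬_; contradiction; Dec; does; yes; no)
open import Relation.Nullary.Decidable using (map′; toWitness; _→-dec_; ¬?)
open import Relation.Unary using (Decidable)
open import Data.Bool using (if_then_else_)
open import Algebra.Properties.Semiring.Sum +-*-semiring
  using (sum-syntax; sum-cong-≗; sum-replicate-zero; ∑-comm; *-distribˡ-sum; *-distribʳ-sum)
open import Data.Nat.Tactic.RingSolver using (solve-∀)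
open import Relation.Binary.PropositionalEquality
open import Algebra.Properties.CommutativeSemigroup +-commutativeSemigroup using (interchange)

-- Walks

module _ {G : Graph} where

  infixr 5 _++ʷ_

  _++ʷ_ : ∀ {u v w} → Walk G u v → Walk G v w → Walk G u w
  [ _ ]        ++ʷ q = q
  (x ∷⟨ e ⟩ p) ++ʷ q = x ∷⟨ e ⟩ (p ++ʷ q)

  len-++ʷ : ∀ {u v w} (p : Walk G u v) (q : Walk G v w) → len (p ++ʷ q) ≡ len p + len q
  len-++ʷ [ _ ]        q = refl
  len-++ʷ (x ∷⟨ e ⟩ p) q = cong suc (len-++ʷ p q)

  ∈ʷ-start : ∀ {u v} (p : Walk G u v) → u ∈W p
  ∈ʷ-start [ x ]        = here₀
  ∈ʷ-start (x ∷⟨ e ⟩ p) = here e p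

  ∈ʷ-end : ∀ {u v} (p : Walk G u v) → v ∈W p
  ∈ʷ-end [ x ]        = here₀
  ∈ʷ-end (x ∷⟨ e ⟩ p) = there e (∈ʷ-end p)

  ∈ʷ-++⁺ˡ : ∀ {u v w a} {p : Walk G u v} (q : Walk G v w) → a ∈W p → a ∈W (p ++ʷ q)
  ∈ʷ-++⁺ˡ q here₀       = ∈ʷ-start q
  ∈ʷ-++⁺ˡ q (here e p)  = here e (p ++ʷ q)
  ∈ʷ-++⁺ˡ q (there e m) = there e (∈ʷ-++⁺ˡ q m)

  ∈ʷ-++⁺ʳ : ∀ {u v w a} (p : Walk G u v) {q : Walk G v w} → a ∈W q → a ∈W (p ++ʷ q)
  ∈ʷ-++⁺ʳ [ x ]        m = m
  ∈ʷ-++⁺ʳ (x ∷⟨ e ⟩ p) m = there e (∈ʷ-++⁺ʳ p m)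

  reverseʷ : (∀ {a b} → Adj G a b → Adj G b a) → ∀ {u v} → Walk G u v → Walk G v u
  reverseʷ sym-adj [ x ]        = [ x ]
  reverseʷ sym-adj (x ∷⟨ e ⟩ p) = reverseʷ sym-adj p ++ʷ (_ ∷⟨ sym-adj e ⟩ [ x ])

  len-reverseʷ : ∀ (sym-adj : ∀ {a b} → Adj G a b → Adj G b a) {u v} (p : Walk G u v) →
                 len (reverseʷ sym-adj p) ≡ len p
  len-reverseʷ sym-adj [ x ]        = refl
  len-reverseʷ sym-adj (x ∷⟨ e ⟩ p) = begin
    len (reverseʷ sym-adj p ++ʷ (_ ∷⟨ sym-adj e ⟩ [ x ])) ≡⟨ len-++ʷ (reverseʷ sym-adj p) _ ⟩
    len (reverseʷ sym-adj p) + 1                          ≡⟨ +-comm _ 1 ⟩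
    suc (len (reverseʷ sym-adj p))                        ≡⟨ cong suc (len-reverseʷ sym-adj p) ⟩
    suc (len p)                                           ∎
    where open ≡-Reasoning

  -- Past the end of the walk, vertexAt returns the final vertex.
  vertexAt : ∀ {u v} → Walk G u v → ℕ → V G
  vertexAt [ x ]        _       = x
  vertexAt (x ∷⟨ e ⟩ w) zero    = x
  vertexAt (x ∷⟨ e ⟩ w) (suc i) = vertexAt w i

  vertexAt-zero : ∀ {u v} (w : Walk G u v) → vertexAt w 0 ≡ u
  vertexAt-zero [ x ]        = refl
  vertexAt-zero (x ∷⟨ e ⟩ w) = refl

  vertexAt-len : ∀ {u v} (w : Walk G u v) → vertexAt w (len w) ≡ v
  vertexAt-len [ x ]        = refl
  vertexAt-len (x ∷⟨ e ⟩ w) = vertexAt-len w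

  ∈ʷ⇒vertexAt : ∀ {u v a} {w : Walk G u v} → a ∈W w → ∃[ i ] i ≤ len w × vertexAt w i ≡ a
  ∈ʷ⇒vertexAt here₀       = 0 , z≤n , refl
  ∈ʷ⇒vertexAt (here e w)  = 0 , z≤n , refl
  ∈ʷ⇒vertexAt (there e m) with ∈ʷ⇒vertexAt m
  ... | i , i≤len , at-i = suc i , s≤s i≤len , at-i

-- Graph metrics and general position

-- The axioms force dist to be the shortest-path distance of G.
record GraphMetric (G : Graph) : Set where
  field
    dist          : V G → V G → ℕ
    dist-refl     : ∀ x → dist x x ≡ 0
    dist-adj      : ∀ {x y} → Adj G x y → dist x y ≤ 1
    dist-triangle : ∀ x y z → dist x z ≤ dist x y + dist y z
    geodesic      : ∀ x y → Σ (Walk G x y) λ w → len w ≡ dist x y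

module _ {G : Graph} (M : GraphMetric G) where
  open GraphMetric M

  record Between (x y z : V G) : Set where
    constructor between
    field additive : dist x y + dist y z ≡ dist x z

  BetweenFree : (V G → Set) → Set
  BetweenFree S = ∀ x y z → S x → S y → S z →
                  ¬ x ≡ y → ¬ x ≡ z → ¬ y ≡ z → ¬ Between x y z

  between-reflˡ : ∀ x z → Between x x z
  between-reflˡ x z = between $ cong (_+ dist x z) (dist-refl x)

  between-reflʳ : ∀ x z → Between x z z
  between-reflʳ x z = between $ trans (cong (dist x z +_) (dist-refl z)) (+-identityʳ _)

  between? : ∀ x y z → Dec (Between x y z)
  between? x y z = map′ between Between.additive (dist x y + dist y z ℕ.≟ dist x z)

  dist≤len : ∀ {u v} (w : Walk G u v) → dist u v ≤ len w
  dist≤len {u} [ _ ] = ≤-reflexive (dist-refl u)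
  dist≤len {u} {v} (_ ∷⟨ e ⟩ w) = ≤-trans (dist-triangle u _ v) (+-mono-≤ (dist-adj e) (dist≤len w))

  dist≡0⇒≡ : ∀ {x y} → dist x y ≡ 0 → x ≡ y
  dist≡0⇒≡ {x} {y} d≡0 with geodesic x y
  ... | [ _ ]        , _      = refl
  ... | (_ ∷⟨ _ ⟩ _) , len≡d = contradiction (trans len≡d d≡0) λ ()

  dist-vertexAt : ∀ {u v} (w : Walk G u v) {i j} → i ≤ j → j ≤ len w →
                  dist (vertexAt w i) (vertexAt w j) + i ≤ j
  dist-vertexAt [ x ] {i} i≤j _ = ≤-trans (≤-reflexive (cong (_+ i) (dist-refl x))) i≤j
  dist-vertexAt (x ∷⟨ e ⟩ w) {zero} {zero} _ _ = ≤-reflexive (cong (_+ 0) (dist-refl x))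
  dist-vertexAt {u} (x ∷⟨ e ⟩ w) {zero} {suc j} _ (s≤s j≤len) = begin
    dist u (vertexAt w j) + 0                         ≡⟨ +-identityʳ _ ⟩
    dist u (vertexAt w j)                             ≤⟨ dist-triangle u (vertexAt w 0) _ ⟩
    dist u (vertexAt w 0) + dist (vertexAt w 0) (vertexAt w j)
      ≤⟨ +-mono-≤ (≤-trans (≤-reflexive (cong (dist u) (vertexAt-zero w))) (dist-adj e))
                  (≤-trans (≤-reflexive (sym (+-identityʳ _))) (dist-vertexAt w z≤n j≤len)) ⟩
    suc j                                             ∎
    where open ≤-Reasoning
  dist-vertexAt (x ∷⟨ e ⟩ w) {suc i} {suc j} (s≤s i≤j) (s≤s j≤len) =
    ≤-trans (≤-reflexive (+-suc _ i)) (s≤s (dist-vertexAt w i≤j j≤len))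

  isShortest⇒len≤dist : ∀ {u v} {p : Walk G u v} → IsShortest p → len p ≤ dist u v
  isShortest⇒len≤dist {u} {v} shortest =
    ≤-trans (shortest (proj₁ (geodesic u v))) (≤-reflexive (proj₂ (geodesic u v)))

  -- The legs u–a, a–b, b–c, c–v of p cost at most their index differences,
  -- which add up to len p = dist u v ≤ dist u a + dist a c + dist c v.
  isShortest⇒between : ∀ {u v} (p : Walk G u v) → IsShortest p → ∀ {i j k} →
    i ≤ j → j ≤ k → k ≤ len p → Between (vertexAt p i) (vertexAt p j) (vertexAt p k)
  isShortest⇒between {u} {v} p shortest {i} {j} {k} i≤j j≤k k≤len =
    between $ ≤-antisym (+-cancelˡ-≤ A _ _ (+-cancelʳ-≤ D _ _ legs≤)) (dist-triangle a b c)
    where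
    a = vertexAt p i
    b = vertexAt p j
    c = vertexAt p k
    A = dist u a
    D = dist c v
    extend : ∀ {x y s t} → x ≤ s → y + s ≤ t → x + y ≤ t
    extend {x} {y} x≤s y+s≤t = ≤-trans (≤-reflexive (+-comm x y)) (≤-trans (+-monoʳ-≤ y x≤s) y+s≤t)
    u→a : A ≤ i
    u→a = ≤-trans (≤-reflexive (trans (sym (+-identityʳ A)) (cong (λ t → dist t a + 0) (sym (vertexAt-zero p)))))
                  (dist-vertexAt p z≤n (≤-trans i≤j (≤-trans j≤k k≤len)))
    c→v : D + k ≤ len p
    c→v = ≤-trans (≤-reflexive (cong (λ t → dist c t + k) (sym (vertexAt-len p))))
                  (dist-vertexAt p k≤len ≤-refl)
    legs≤ : A + (dist a b + dist b c) + D ≤ A + dist a c + D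
    legs≤ = begin
      A + (dist a b + dist b c) + D  ≡⟨ cong (_+ D) (sym (+-assoc A _ _)) ⟩
      A + dist a b + dist b c + D
        ≤⟨ extend (extend (extend u→a (dist-vertexAt p i≤j (≤-trans j≤k k≤len)))
                          (dist-vertexAt p j≤k k≤len)) c→v ⟩
      len p                          ≤⟨ isShortest⇒len≤dist shortest ⟩
      dist u v                       ≤⟨ dist-triangle u c v ⟩
      dist u c + D                   ≤⟨ +-monoˡ-≤ D (dist-triangle u a c) ⟩
      A + dist a c + D               ∎
      where open ≤-Reasoning

  inGeneralPosition⇒betweenFree : ∀ {S} → InGeneralPosition G S → BetweenFree S
  inGeneralPosition⇒betweenFree gp x y z sx sy sz x≢y x≢z y≢z (between xyz) =
    gp (x→y ++ʷ y→z) shortest x y z sx sy sz x≢y x≢z y≢z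
       (∈ʷ-++⁺ˡ y→z (∈ʷ-start x→y)) (∈ʷ-++⁺ʳ x→y (∈ʷ-start y→z)) (∈ʷ-++⁺ʳ x→y (∈ʷ-end y→z))
    where
    x→y = proj₁ (geodesic x y)
    y→z = proj₁ (geodesic y z)
    shortest : IsShortest (x→y ++ʷ y→z)
    shortest q = ≤-trans
      (≤-reflexive (trans (len-++ʷ x→y y→z)
                   (trans (cong₂ _+_ (proj₂ (geodesic x y)) (proj₂ (geodesic y z))) xyz)))
      (dist≤len q)

  betweenFree⇒inGeneralPosition : ∀ {S} → BetweenFree S → InGeneralPosition G S
  betweenFree⇒inGeneralPosition free p shortest x y z sx sy sz x≢y x≢z y≢z x∈p y∈p z∈p
    with ∈ʷ⇒vertexAt x∈p | ∈ʷ⇒vertexAt y∈p | ∈ʷ⇒vertexAt z∈p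
  ... | i , i≤ , refl | j , j≤ , refl | k , k≤ , refl = order (≤-total i j) (≤-total j k) (≤-total i k)
    where
    ordered = isShortest⇒between p shortest
    order : i ≤ j ⊎ j ≤ i → j ≤ k ⊎ k ≤ j → i ≤ k ⊎ k ≤ i → ⊥
    order (inj₁ i≤j) (inj₁ j≤k) _ = free _ _ _ sx sy sz x≢y x≢z y≢z (ordered i≤j j≤k k≤)
    order (inj₂ j≤i) (inj₂ k≤j) _ =
      free _ _ _ sz sy sx (y≢z ∘ sym) (x≢z ∘ sym) (x≢y ∘ sym) (ordered k≤j j≤i i≤)
    order (inj₁ i≤j) (inj₂ k≤j) (inj₁ i≤k) = free _ _ _ sx sz sy x≢z x≢y (y≢z ∘ sym) (ordered i≤k k≤j j≤)
    order (inj₁ i≤j) (inj₂ k≤j) (inj₂ k≤i) = free _ _ _ sz sx sy (x≢z ∘ sym) (y≢z ∘ sym) x≢y (ordered k≤i i≤j j≤)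
    order (inj₂ j≤i) (inj₁ j≤k) (inj₁ i≤k) = free _ _ _ sy sx sz (x≢y ∘ sym) y≢z x≢z (ordered j≤i i≤k k≤)
    order (inj₂ j≤i) (inj₁ j≤k) (inj₂ k≤i) = free _ _ _ sy sz sx y≢z (x≢y ∘ sym) (x≢z ∘ sym) (ordered j≤k k≤i i≤)

module _ {G H : Graph} (MG : GraphMetric G) (MH : GraphMetric H) where
  private
    module G = GraphMetric MG
    module H = GraphMetric MH

  betweenFree-pullback : (f : V G → V H) {S : V G → Set} {T : V H → Set} →
    (∀ {x y} → S x → S y → H.dist (f x) (f y) ≡ G.dist x y) → (∀ {x} → S x → T (f x)) →
    BetweenFree MH T → BetweenFree MG S
  betweenFree-pullback f {S} isometric S⇒T free x y z sx sy sz x≢y x≢z y≢z (between xyz) =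
    free (f x) (f y) (f z) (S⇒T sx) (S⇒T sy) (S⇒T sz)
         (x≢y ∘ injective sx sy) (x≢z ∘ injective sx sz) (y≢z ∘ injective sy sz)
         (between (trans (cong₂ _+_ (isometric sx sy) (isometric sy sz)) (trans xyz (sym (isometric sx sz)))))
    where
    injective : ∀ {x y} → S x → S y → f x ≡ f y → x ≡ y
    injective {x} sx sy fx≡fy =
      dist≡0⇒≡ MG (trans (sym (isometric sx sy)) (trans (cong (H.dist (f x)) (sym fx≡fy)) (H.dist-refl (f x))))

-- Paths and Cartesian products

P-sym : ∀ {m} {i j : Fin m} → Adj (P m) i j → Adj (P m) j i
P-sym (inj₁ i+1≡j) = inj₂ i+1≡j
P-sym (inj₂ j+1≡i) = inj₁ j+1≡i

ascendingWalk : ∀ {m} d (i j : Fin m) → toℕ i + d ≡ toℕ j → Σ (Walk (P m) i j) λ w → len w ≡ d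
ascendingWalk zero i j i+0≡j with toℕ-injective {i = i} {j} (trans (sym (+-identityʳ (toℕ i))) i+0≡j)
... | refl = [ i ] , refl
ascendingWalk {m} (suc d) i j i+d+1≡j =
  (i ∷⟨ inj₁ (sym (toℕ-fromℕ< i+1<m)) ⟩ proj₁ rest) , cong suc (proj₂ rest)
  where
  i+1+d≡j : suc (toℕ i) + d ≡ toℕ j
  i+1+d≡j = trans (sym (+-suc (toℕ i) d)) i+d+1≡j
  i+1<m : suc (toℕ i) < m
  i+1<m = <-≤-trans (s≤s (≤-trans (m≤m+n _ d) (≤-reflexive i+1+d≡j))) (toℕ<n j)
  rest = ascendingWalk d (fromℕ< i+1<m) j (trans (cong (_+ d) (toℕ-fromℕ< i+1<m)) i+1+d≡j)

pathGeodesic : ∀ {m} (i j : Fin m) → Σ (Walk (P m) i j) λ w → len w ≡ ∣ toℕ i - toℕ j ∣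
pathGeodesic i j with ≤-total (toℕ i) (toℕ j)
... | inj₁ i≤j = let (w , len≡) = ascendingWalk _ i j (m+[n∸m]≡n i≤j)
                 in w , trans len≡ (sym (m≤n⇒∣m-n∣≡n∸m i≤j))
... | inj₂ j≤i = let (w , len≡) = ascendingWalk _ j i (m+[n∸m]≡n j≤i)
                 in reverseʷ P-sym w , trans (len-reverseʷ P-sym w) (trans len≡ (sym (m≤n⇒∣n-m∣≡n∸m j≤i)))

∣m-1+m∣≡1 : ∀ m → ∣ m - suc m ∣ ≡ 1
∣m-1+m∣≡1 m = trans (cong (∣ m -_∣) (+-comm 1 m)) (∣m-m+n∣≡n m 1)

∣-∣-adj : ∀ {m} {i j : Fin m} → Adj (P m) i j → ∣ toℕ i - toℕ j ∣ ≤ 1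
∣-∣-adj {i = i} (inj₁ i+1≡j) = ≤-reflexive (trans (cong (∣ toℕ i -_∣) (sym i+1≡j)) (∣m-1+m∣≡1 (toℕ i)))
∣-∣-adj {j = j} (inj₂ j+1≡i) =
  ≤-reflexive (trans (cong ∣_- toℕ j ∣ (sym j+1≡i)) (trans (∣-∣-comm (suc (toℕ j)) (toℕ j)) (∣m-1+m∣≡1 (toℕ j))))

pathMetric : ∀ m → GraphMetric (P m)
pathMetric m = record
  { dist          = λ i j → ∣ toℕ i - toℕ j ∣
  ; dist-refl     = λ i → ∣n-n∣≡0 (toℕ i)
  ; dist-adj      = ∣-∣-adj
  ; dist-triangle = λ i j k → ∣-∣-triangle (toℕ i) (toℕ j) (toℕ k)
  ; geodesic      = pathGeodesic
  }

∣-∣-monotone : ∀ {a b c} → a ≤ b → b ≤ c → ∣ a - b ∣ + ∣ b - c ∣ ≡ ∣ a - c ∣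
∣-∣-monotone {b = b} z≤n b≤c = trans (cong (b +_) (m≤n⇒∣m-n∣≡n∸m b≤c)) (m+[n∸m]≡n b≤c)
∣-∣-monotone (s≤s a≤b) (s≤s b≤c) = ∣-∣-monotone a≤b b≤c

between-path : ∀ {m} {i j k : Fin m} → toℕ i ≤ toℕ j → toℕ j ≤ toℕ k → Between (pathMetric m) i j k
between-path i≤j j≤k = between (∣-∣-monotone i≤j j≤k)

between-path-flip : ∀ {m} {i j k : Fin m} → Between (pathMetric m) i j k → Between (pathMetric m) k j i
between-path-flip {i = i} {j} {k} (between ijk) = between $ begin
  ∣ toℕ k - toℕ j ∣ + ∣ toℕ j - toℕ i ∣ ≡⟨ +-comm ∣ toℕ k - toℕ j ∣ _ ⟩
  ∣ toℕ j - toℕ i ∣ + ∣ toℕ k - toℕ j ∣ ≡⟨ cong₂ _+_ (∣-∣-comm (toℕ j) _) (∣-∣-comm (toℕ k) _) ⟩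
  ∣ toℕ i - toℕ j ∣ + ∣ toℕ j - toℕ k ∣ ≡⟨ ijk ⟩
  ∣ toℕ i - toℕ k ∣                     ≡⟨ ∣-∣-comm (toℕ i) _ ⟩
  ∣ toℕ k - toℕ i ∣                     ∎
  where open ≡-Reasoning

module _ {G H : Graph} where

  □-walkˡ : ∀ {g g'} (h : V H) → Walk G g g' → Walk (G □ H) (g , h) (g' , h)
  □-walkˡ h [ g ]        = [ g , h ]
  □-walkˡ h (g ∷⟨ e ⟩ w) = (g , h) ∷⟨ inj₂ (refl , e) ⟩ □-walkˡ h w

  □-walkʳ : ∀ {h h'} (g : V G) → Walk H h h' → Walk (G □ H) (g , h) (g , h')
  □-walkʳ g [ h ]        = [ g , h ]
  □-walkʳ g (h ∷⟨ e ⟩ w) = (g , h) ∷⟨ inj₁ (refl , e) ⟩ □-walkʳ g w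

  len-□-walkˡ : ∀ {g g'} (h : V H) (w : Walk G g g') → len (□-walkˡ h w) ≡ len w
  len-□-walkˡ h [ g ]        = refl
  len-□-walkˡ h (g ∷⟨ e ⟩ w) = cong suc (len-□-walkˡ h w)

  len-□-walkʳ : ∀ {h h'} (g : V G) (w : Walk H h h') → len (□-walkʳ g w) ≡ len w
  len-□-walkʳ g [ h ]        = refl
  len-□-walkʳ g (h ∷⟨ e ⟩ w) = cong suc (len-□-walkʳ g w)

  productMetric : GraphMetric G → GraphMetric H → GraphMetric (G □ H)
  productMetric MG MH = record
    { dist          = λ (g , h) (g' , h') → G.dist g g' + H.dist h h'
    ; dist-refl     = λ (g , h) → cong₂ _+_ (G.dist-refl g) (H.dist-refl h)
    ; dist-adj      = adj
    ; dist-triangle = λ (g , h) (g' , h') (g'' , h'') →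
        ≤-trans (+-mono-≤ (G.dist-triangle g g' g'') (H.dist-triangle h h' h''))
                (≤-reflexive (interchange (G.dist g g') _ _ _))
    ; geodesic      = geodesic
    }
    where
    module G = GraphMetric MG
    module H = GraphMetric MH
    adj : ∀ {x y} → Adj (G □ H) x y → G.dist (proj₁ x) (proj₁ y) + H.dist (proj₂ x) (proj₂ y) ≤ 1
    adj {g , _} (inj₁ (refl , e)) = ≤-trans (≤-reflexive (cong (_+ _) (G.dist-refl g))) (H.dist-adj e)
    adj {_ , h} (inj₂ (refl , e)) =
      ≤-trans (≤-reflexive (trans (cong (_ +_) (H.dist-refl h)) (+-identityʳ _))) (G.dist-adj e)
    geodesic : ∀ x y → Σ (Walk (G □ H) x y) λ w →
               len w ≡ G.dist (proj₁ x) (proj₁ y) + H.dist (proj₂ x) (proj₂ y)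
    geodesic (g , h) (g' , h') =
      (□-walkˡ h g→g' ++ʷ □-walkʳ g' h→h') ,
      trans (len-++ʷ (□-walkˡ h g→g') _)
            (cong₂ _+_ (trans (len-□-walkˡ h g→g') (proj₂ (G.geodesic g g')))
                       (trans (len-□-walkʳ g' h→h') (proj₂ (H.geodesic h h'))))
      where
      g→g' = proj₁ (G.geodesic g g')
      h→h' = proj₁ (H.geodesic h h')

  between-□ : ∀ (MG : GraphMetric G) (MH : GraphMetric H) {g g' g'' h h' h''} →
    Between MG g g' g'' → Between MH h h' h'' → Between (productMetric MG MH) (g , h) (g' , h') (g'' , h'')
  between-□ MG MH {g} {g'} (between gg'g'') (between hh'h'') = between $
    trans (interchange (G.dist g g') _ _ _) (cong₂ _+_ gg'g'' hh'h'')
    where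
    module G = GraphMetric MG

-- General position in grids

Grid : ℕ → ℕ → Graph
Grid m n = P m □ P n

gridMetric : ∀ m n → GraphMetric (Grid m n)
gridMetric m n = productMetric (pathMetric m) (pathMetric n)

between-grid : ∀ {m n} {r r' r'' : Fin m} {j j' j'' : Fin n} → Between (pathMetric m) r r' r'' →
  toℕ j ≤ toℕ j' → toℕ j' ≤ toℕ j'' → Between (gridMetric m n) (r , j) (r' , j') (r'' , j'')
between-grid rows j≤j' j'≤j'' = between-□ (pathMetric _) (pathMetric _) rows (between-path j≤j' j'≤j'')

≢-row : ∀ {m n} {r r' : Fin m} {j j' : Fin n} → ¬ r ≡ r' → ¬ (r , j) ≡ (r' , j')
≢-row r≢r' refl = r≢r' refl

≢-col : ∀ {m n} {r r' : Fin m} {j j' : Fin n} → toℕ j < toℕ j' → ¬ (r , j) ≡ (r' , j')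
≢-col j<j' refl = <-irrefl refl j<j'

module _ {m n : ℕ} {S : V (Grid m n) → Set} (free : BetweenFree (gridMetric m n) S) where

  ¬threeInRow : ∀ r {j₁ j₂ j₃} → toℕ j₁ < toℕ j₂ → toℕ j₂ < toℕ j₃ →
                S (r , j₁) → S (r , j₂) → S (r , j₃) → ⊥
  ¬threeInRow r j₁<j₂ j₂<j₃ s₁ s₂ s₃ =
    free _ _ _ s₁ s₂ s₃ (≢-col j₁<j₂) (≢-col (<-trans j₁<j₂ j₂<j₃)) (≢-col j₂<j₃)
         (between-grid (between-reflˡ (pathMetric m) r r) (<⇒≤ j₁<j₂) (<⇒≤ j₂<j₃))

  ¬twoRowPairs : ∀ {r r'} → ¬ r ≡ r' → ∀ {j₁ j₂ j₁' j₂'} → toℕ j₁ < toℕ j₂ → toℕ j₁' < toℕ j₂' →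
                 S (r , j₁) → S (r , j₂) → S (r' , j₁') → S (r' , j₂') → ⊥
  ¬twoRowPairs {r} {r'} r≢r' {j₁} {j₂} {j₁'} j₁<j₂ j₁'<j₂' s₁ s₂ s₁' s₂' with ≤-total (toℕ j₁) (toℕ j₁')
  ... | inj₁ j₁≤j₁' = free _ _ _ s₁ s₁' s₂' (≢-row r≢r') (≢-row r≢r') (≢-col j₁'<j₂')
                           (between-grid (between-reflʳ (pathMetric m) r r') j₁≤j₁' (<⇒≤ j₁'<j₂'))
  ... | inj₂ j₁'≤j₁ = free _ _ _ s₁' s₁ s₂ (≢-row (r≢r' ∘ sym)) (≢-row (r≢r' ∘ sym)) (≢-col j₁<j₂)
                           (between-grid (between-reflʳ (pathMetric m) r' r) j₁'≤j₁ (<⇒≤ j₁<j₂))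

  -- Whatever the column order, three of the four points form a between triple.
  ¬rowPairWithMiddleAndFar : ∀ {r₁ r₂ r₃} → ¬ r₁ ≡ r₂ → ¬ r₁ ≡ r₃ → ¬ r₂ ≡ r₃ →
    Between (pathMetric m) r₁ r₂ r₃ → ∀ {p₁ p₂ q x} → toℕ p₁ < toℕ p₂ →
    S (r₁ , p₁) → S (r₁ , p₂) → S (r₃ , q) → S (r₂ , x) → ⊥
  ¬rowPairWithMiddleAndFar {r₁} {r₂} {r₃} r₁≢r₂ r₁≢r₃ r₂≢r₃ r₁r₂r₃ {p₁} {p₂} {q} {x} p₁<p₂ s₁ s₂ sq sx
    with ≤-total (toℕ q) (toℕ p₁) | ≤-total (toℕ p₂) (toℕ q)
  ... | inj₁ q≤p₁ | _ =
    free _ _ _ sq s₁ s₂ (≢-row (r₁≢r₃ ∘ sym)) (≢-row (r₁≢r₃ ∘ sym)) (≢-col p₁<p₂)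
         (between-grid (between-reflʳ (pathMetric m) r₃ r₁) q≤p₁ (<⇒≤ p₁<p₂))
  ... | inj₂ _ | inj₁ p₂≤q =
    free _ _ _ s₁ s₂ sq (≢-col p₁<p₂) (≢-row r₁≢r₃) (≢-row r₁≢r₃)
         (between-grid (between-reflˡ (pathMetric m) r₁ r₃) (<⇒≤ p₁<p₂) p₂≤q)
  ... | inj₂ p₁≤q | inj₂ q≤p₂ with ≤-total (toℕ x) (toℕ p₁) | ≤-total (toℕ x) (toℕ q) | ≤-total (toℕ x) (toℕ p₂)
  ...   | inj₁ x≤p₁ | _ | _ =
    free _ _ _ sx s₁ s₂ (≢-row (r₁≢r₂ ∘ sym)) (≢-row (r₁≢r₂ ∘ sym)) (≢-col p₁<p₂)
         (between-grid (between-reflʳ (pathMetric m) r₂ r₁) x≤p₁ (<⇒≤ p₁<p₂))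
  ...   | inj₂ p₁≤x | inj₁ x≤q | _ =
    free _ _ _ s₁ sx sq (≢-row r₁≢r₂) (≢-row r₁≢r₃) (≢-row r₂≢r₃) (between-grid r₁r₂r₃ p₁≤x x≤q)
  ...   | inj₂ _ | inj₂ q≤x | inj₁ x≤p₂ =
    free _ _ _ sq sx s₂ (≢-row (r₂≢r₃ ∘ sym)) (≢-row (r₁≢r₃ ∘ sym)) (≢-row (r₁≢r₂ ∘ sym))
         (between-grid (between-path-flip r₁r₂r₃) q≤x x≤p₂)
  ...   | inj₂ _ | inj₂ _ | inj₂ p₂≤x =
    free _ _ _ s₁ s₂ sx (≢-col p₁<p₂) (≢-row r₁≢r₂) (≢-row r₁≢r₂)
         (between-grid (between-reflˡ (pathMetric m) r₁ r₂) (<⇒≤ p₁<p₂) p₂≤x)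

-- The lower bound

iverson : ∀ {A : Set} → Dec A → ℕ
iverson a? = if does a? then 1 else 0

count : ∀ {n} {P : Fin n → Set} → Decidable P → ℕ
count {n} P? = ∑[ j < n ] iverson (P? j)

1≤count⇒∃ : ∀ {n} {P : Fin n → Set} (P? : Decidable P) → 1 ≤ count P? → ∃ P
1≤count⇒∃ {suc n} {P} P? = go (P? Fin.zero)
  where
  go : (p? : Dec (P Fin.zero)) → 1 ≤ iverson p? + count (P? ∘ Fin.suc) → ∃ P
  go (yes p) _   = Fin.zero , p
  go (no _)  1≤c = let (j , pj) = 1≤count⇒∃ (P? ∘ Fin.suc) 1≤c in Fin.suc j , pj

2≤count⇒∃₂ : ∀ {n} {P : Fin n → Set} (P? : Decidable P) → 2 ≤ count P? →
             ∃₂ λ i j → toℕ i < toℕ j × P i × P j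
2≤count⇒∃₂ {suc n} {P} P? = go (P? Fin.zero)
  where
  go : (p? : Dec (P Fin.zero)) → 2 ≤ iverson p? + count (P? ∘ Fin.suc) → ∃₂ λ i j → toℕ i < toℕ j × P i × P j
  go (yes p) (s≤s 1≤c) = let (j , pj) = 1≤count⇒∃ (P? ∘ Fin.suc) 1≤c in Fin.zero , Fin.suc j , s≤s z≤n , p , pj
  go (no _)  2≤c       = let (i , j , i<j , pi , pj) = 2≤count⇒∃₂ (P? ∘ Fin.suc) 2≤c
                         in Fin.suc i , Fin.suc j , s≤s i<j , pi , pj

3≤count⇒∃₃ : ∀ {n} {P : Fin n → Set} (P? : Decidable P) → 3 ≤ count P? →
             ∃₂ λ i j → ∃ λ k → toℕ i < toℕ j × toℕ j < toℕ k × P i × P j × P k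
3≤count⇒∃₃ {suc n} {P} P? = go (P? Fin.zero)
  where
  go : (p? : Dec (P Fin.zero)) → 3 ≤ iverson p? + count (P? ∘ Fin.suc) →
       ∃₂ λ i j → ∃ λ k → toℕ i < toℕ j × toℕ j < toℕ k × P i × P j × P k
  go (yes p) (s≤s 2≤c) = let (j , k , j<k , pj , pk) = 2≤count⇒∃₂ (P? ∘ Fin.suc) 2≤c
                         in Fin.zero , Fin.suc j , Fin.suc k , s≤s z≤n , s≤s j<k , p , pj , pk
  go (no _)  3≤c       = let (i , j , k , i<j , j<k , pi , pj , pk) = 3≤count⇒∃₃ (P? ∘ Fin.suc) 3≤c
                         in Fin.suc i , Fin.suc j , Fin.suc k , s≤s i<j , s≤s j<k , pi , pj , pk

∑-iverson-≟ : ∀ {k} (x : Fin k) → ∑[ i < k ] iverson (x ≟ i) ≡ 1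
∑-iverson-≟ {suc k} Fin.zero    = cong suc (sum-replicate-zero k)
∑-iverson-≟         (Fin.suc x) = ∑-iverson-≟ x

∑-1 : ∀ n → ∑[ j < n ] 1 ≡ n
∑-1 zero    = refl
∑-1 (suc n) = cong suc (∑-1 n)

∑-count-≟ : ∀ {n k} (f : Fin n → Fin k) → ∑[ i < k ] count (λ j → f j ≟ i) ≡ n
∑-count-≟ {n} {k} f = begin
  ∑[ i < k ] ∑[ j < n ] iverson (f j ≟ i) ≡⟨ ∑-comm (λ i j → iverson (f j ≟ i)) ⟩
  ∑[ j < n ] ∑[ i < k ] iverson (f j ≟ i) ≡⟨ sum-cong-≗ (∑-iverson-≟ ∘ f) ⟩
  ∑[ j < n ] 1                            ≡⟨ ∑-1 n ⟩
  n                                       ∎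
  where open ≡-Reasoning

∑-≤ : ∀ {k b} (f : Fin k → ℕ) → (∀ i → f i ≤ b) → ∑[ i < k ] f i ≤ k * b
∑-≤ {zero}  f f≤b = z≤n
∑-≤ {suc k} f f≤b = +-mono-≤ (f≤b Fin.zero) (∑-≤ (f ∘ Fin.suc) (f≤b ∘ Fin.suc))

rowCount : ∀ {m n} {S : V (Grid m n) → Set} → Decidable S → Fin m → ℕ
rowCount S? r = count (λ j → S? (r , j))

weight : ∀ {m n} {S : V (Grid m n) → Set} → (Fin m → ℕ) → Decidable S → ℕ
weight {m} w S? = ∑[ r < m ] (w r * rowCount S? r)

module _ {m n : ℕ} {S : V (Grid m n) → Set} (S? : Decidable S) (free : BetweenFree (gridMetric m n) S) where

  rowCount≤2 : ∀ r → rowCount S? r ≤ 2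
  rowCount≤2 r = ≮⇒≥ λ 3≤c →
    let (_ , _ , _ , j₁<j₂ , j₂<j₃ , s₁ , s₂ , s₃) = 3≤count⇒∃₃ (λ j → S? (r , j)) 3≤c
    in ¬threeInRow free r j₁<j₂ j₂<j₃ s₁ s₂ s₃

  rowPair⇒rowCount≤1 : ∀ {r r'} → ¬ r ≡ r' → 2 ≤ rowCount S? r → rowCount S? r' ≤ 1
  rowPair⇒rowCount≤1 {r} {r'} r≢r' 2≤c = ≮⇒≥ λ 2≤c' →
    let (_ , _ , j₁<j₂ , s₁ , s₂)     = 2≤count⇒∃₂ (λ j → S? (r , j)) 2≤c
        (_ , _ , j₁'<j₂' , s₁' , s₂') = 2≤count⇒∃₂ (λ j → S? (r' , j)) 2≤c'
    in ¬twoRowPairs free r≢r' j₁<j₂ j₁'<j₂' s₁ s₂ s₁' s₂'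

  rowPair⇒middleRowCount≤0 : ∀ {r₁ r₂ r₃} → ¬ r₁ ≡ r₂ → ¬ r₁ ≡ r₃ → ¬ r₂ ≡ r₃ →
    Between (pathMetric m) r₁ r₂ r₃ → 2 ≤ rowCount S? r₁ → 1 ≤ rowCount S? r₃ → rowCount S? r₂ ≤ 0
  rowPair⇒middleRowCount≤0 {r₁} {r₂} {r₃} r₁≢r₂ r₁≢r₃ r₂≢r₃ r₁r₂r₃ 2≤c₁ 1≤c₃ = ≮⇒≥ λ 1≤c₂ →
    let (_ , _ , p₁<p₂ , s₁ , s₂) = 2≤count⇒∃₂ (λ j → S? (r₁ , j)) 2≤c₁
        (_ , sq)                  = 1≤count⇒∃ (λ j → S? (r₃ , j)) 1≤c₃
        (_ , sx)                  = 1≤count⇒∃ (λ j → S? (r₂ , j)) 1≤c₂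
    in ¬rowPairWithMiddleAndFar free r₁≢r₂ r₁≢r₃ r₂≢r₃ r₁r₂r₃ p₁<p₂ s₁ s₂ sq sx

rowWeight₃ : Fin 3 → ℕ
rowWeight₃ 1F = 1
rowWeight₃ _  = 2

outerPairWeight≤6 : ∀ {a b c} → a ≤ 2 → b ≤ 2 → c ≤ 1 → (1 ≤ c → b ≤ 0) → 2 * a + b + 2 * c ≤ 6
outerPairWeight≤6 a≤2 b≤2 z≤n       _   = +-mono-≤ (+-mono-≤ (*-monoʳ-≤ 2 a≤2) b≤2) z≤n
outerPairWeight≤6 a≤2 _   (s≤s z≤n) b≤0 = +-mono-≤ (+-mono-≤ (*-monoʳ-≤ 2 a≤2) (b≤0 (s≤s z≤n))) ≤-refl

weight≤6 : ∀ {n} {S : V (Grid 3 n) → Set} (S? : Decidable S) → BetweenFree (gridMetric 3 n) S →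
           weight rowWeight₃ S? ≤ 6
weight≤6 S? free = ≤-trans (≤-reflexive (weight-rows a b c)) bound
  where
  a = rowCount S? 0F
  b = rowCount S? 1F
  c = rowCount S? 2F
  weight-rows : ∀ a b c → 2 * a + (1 * b + (2 * c + 0)) ≡ 2 * a + b + 2 * c
  weight-rows = solve-∀
  mirror : ∀ a b c → 2 * a + b + 2 * c ≡ 2 * c + b + 2 * a
  mirror = solve-∀
  r₁r₂r₃ : Between (pathMetric 3) 0F 1F 2F
  r₁r₂r₃ = between refl
  bound : 2 * a + b + 2 * c ≤ 6
  bound with a ≤? 1 | c ≤? 1
  ... | yes a≤1 | yes c≤1 =
    +-mono-≤ (+-mono-≤ (*-monoʳ-≤ 2 a≤1) (rowCount≤2 S? free 1F)) (*-monoʳ-≤ 2 c≤1)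
  ... | no a≰1 | _ =
    outerPairWeight≤6 (rowCount≤2 S? free 0F) (rowCount≤2 S? free 1F)
      (rowPair⇒rowCount≤1 S? free (λ ()) (≰⇒> a≰1))
      (rowPair⇒middleRowCount≤0 S? free (λ ()) (λ ()) (λ ()) r₁r₂r₃ (≰⇒> a≰1))
  ... | yes _ | no c≰1 = ≤-trans (≤-reflexive (mirror a b c))
    (outerPairWeight≤6 (rowCount≤2 S? free 2F) (rowCount≤2 S? free 1F)
      (rowPair⇒rowCount≤1 S? free (λ ()) (≰⇒> c≰1))
      (rowPair⇒middleRowCount≤0 S? free (λ ()) (λ ()) (λ ()) (between-path-flip r₁r₂r₃) (≰⇒> c≰1)))

colourClass? : ∀ {A : Set} {k} (c : A → Fin k) (i : Fin k) → Decidable (λ v → c v ≡ i)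
colourClass? c i v = c v ≟ i

module _ {m n k : ℕ} (w : Fin m → ℕ) (c : V (Grid m n) → Fin k) where

  ∑-weight-colourClass : ∑[ i < k ] weight w (colourClass? c i) ≡ (∑[ r < m ] w r) * n
  ∑-weight-colourClass = begin
    ∑[ i < k ] ∑[ r < m ] (w r * rowCount (colourClass? c i) r)
      ≡⟨ ∑-comm (λ i r → w r * rowCount (colourClass? c i) r) ⟩
    ∑[ r < m ] ∑[ i < k ] (w r * rowCount (colourClass? c i) r)
      ≡⟨ sum-cong-≗ (λ r → sym (*-distribˡ-sum (w r) (λ i → rowCount (colourClass? c i) r))) ⟩
    ∑[ r < m ] (w r * ∑[ i < k ] rowCount (colourClass? c i) r)
      ≡⟨ sum-cong-≗ (λ r → cong (w r *_) (∑-count-≟ (λ j → c (r , j)))) ⟩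
    ∑[ r < m ] (w r * n)
      ≡⟨ sym (*-distribʳ-sum n w) ⟩
    (∑[ r < m ] w r) * n
      ∎
    where open ≡-Reasoning

  gpColouring⇒weight≤ : ∀ {B} → (∀ {S} (S? : Decidable S) → BetweenFree (gridMetric m n) S → weight w S? ≤ B) →
                        IsGPColouring (Grid m n) k c → (∑[ r < m ] w r) * n ≤ k * B
  gpColouring⇒weight≤ bound gp = begin
    (∑[ r < m ] w r) * n                    ≡⟨ sym ∑-weight-colourClass ⟩
    ∑[ i < k ] weight w (colourClass? c i)
      ≤⟨ ∑-≤ _ (λ i → bound (colourClass? c i) (inGeneralPosition⇒betweenFree (gridMetric m n) (gp i))) ⟩
    k * _                                   ∎
    where open ≤-Reasoning

-- The upper bound

module Tiling {m w p : ℕ} (tile : V (Grid m w) → Fin p) (tile-gp : IsGPColouring (Grid m w) p tile)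
              {n b : ℕ} (n≤b*w : n ≤ b * w) where

  blockOf : Fin n → Fin b
  blockOf j = proj₁ (remQuot {b} w (inject≤ j n≤b*w))

  offset : Fin n → Fin w
  offset j = proj₂ (remQuot {b} w (inject≤ j n≤b*w))

  toℕ-blockOf-offset : ∀ j → toℕ j ≡ w * toℕ (blockOf j) + toℕ (offset j)
  toℕ-blockOf-offset j = begin
    toℕ j                                ≡⟨ toℕ-inject≤ j n≤b*w ⟨
    toℕ (inject≤ j n≤b*w)                ≡⟨ cong toℕ (combine-remQuot {b} w (inject≤ j n≤b*w)) ⟨
    toℕ (combine (blockOf j) (offset j)) ≡⟨ toℕ-combine (blockOf j) (offset j) ⟩
    w * toℕ (blockOf j) + toℕ (offset j) ∎
    where open ≡-Reasoning

  ∣-∣-sameBlock : ∀ {j j'} → blockOf j ≡ blockOf j' → ∣ toℕ j - toℕ j' ∣ ≡ ∣ toℕ (offset j) - toℕ (offset j') ∣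
  ∣-∣-sameBlock {j} {j'} sameBlock = begin
    ∣ toℕ j - toℕ j' ∣
      ≡⟨ cong₂ ∣_-_∣ (toℕ-blockOf-offset j)
                     (trans (toℕ-blockOf-offset j') (cong (λ β → w * toℕ β + toℕ (offset j')) (sym sameBlock))) ⟩
    ∣ w * toℕ (blockOf j) + toℕ (offset j) - w * toℕ (blockOf j) + toℕ (offset j') ∣
      ≡⟨ ∣m+n-m+o∣≡∣n-o∣ (w * toℕ (blockOf j)) _ _ ⟩
    ∣ toℕ (offset j) - toℕ (offset j') ∣
      ∎
    where open ≡-Reasoning

  toTile : V (Grid m n) → V (Grid m w)
  toTile (r , j) = r , offset j

  tiledColouring : V (Grid m n) → Fin (b * p)
  tiledColouring v = combine (blockOf (proj₂ v)) (tile (toTile v))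

  tiledColouring-gp : IsGPColouring (Grid m n) (b * p) tiledColouring
  tiledColouring-gp i = betweenFree⇒inGeneralPosition (gridMetric m n)
    (betweenFree-pullback (gridMetric m n) (gridMetric m w) toTile {T = tileClass} isometric (,-injectiveʳ ∘ split)
      (inGeneralPosition⇒betweenFree (gridMetric m w) (tile-gp (proj₂ (remQuot {b} p i)))))
    where
    tileClass : V (Grid m w) → Set
    tileClass t = tile t ≡ proj₂ (remQuot {b} p i)
    split : ∀ {v} → tiledColouring v ≡ i → (blockOf (proj₂ v) , tile (toTile v)) ≡ remQuot {b} p i
    split v∈i = trans (sym (remQuot-combine _ _)) (cong (remQuot {b} p) v∈i)
    isometric : ∀ {x y} → tiledColouring x ≡ i → tiledColouring y ≡ i →
      GraphMetric.dist (gridMetric m w) (toTile x) (toTile y) ≡ GraphMetric.dist (gridMetric m n) x y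
    isometric {r , _} {r' , _} x∈i y∈i = cong (∣ toℕ r - toℕ r' ∣ +_)
      (sym (∣-∣-sameBlock (trans (,-injectiveˡ (split x∈i)) (sym (,-injectiveˡ (split y∈i))))))

-- Every colour class has weight exactly 6, so weight≤6 is attained.
tile₁₂ : V (Grid 3 12) → Fin 10
tile₁₂ (r , j) = lookup (lookup table r) j
  where
  table : Vec (Vec (Fin 10) 12) 3
  table = (# 6 ∷ # 0 ∷ # 1 ∷ # 7 ∷ # 6 ∷ # 2 ∷ # 3 ∷ # 8 ∷ # 9 ∷ # 4 ∷ # 5 ∷ # 8 ∷ [])
        ∷ (# 0 ∷ # 1 ∷ # 0 ∷ # 1 ∷ # 2 ∷ # 3 ∷ # 2 ∷ # 3 ∷ # 4 ∷ # 5 ∷ # 4 ∷ # 5 ∷ [])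
        ∷ (# 7 ∷ # 0 ∷ # 1 ∷ # 6 ∷ # 7 ∷ # 2 ∷ # 3 ∷ # 9 ∷ # 8 ∷ # 4 ∷ # 5 ∷ # 9 ∷ [])
        ∷ []

tile₁₂-gp : IsGPColouring (Grid 3 12) 10 tile₁₂
tile₁₂-gp i = betweenFree⇒inGeneralPosition (gridMetric 3 12) λ x y z x∈i y∈i z∈i →
  monochromatic-betweenFree x y z (trans x∈i (sym y∈i)) (trans y∈i (sym z∈i))
  where
  Vertex = V (Grid 3 12)
  _≟ᵥ_ : (x y : Vertex) → Dec (x ≡ y)
  _≟ᵥ_ = ≡-dec _≟_ _≟_
  all-vertices? : {Q : Vertex → Set} → Decidable Q → Dec (∀ v → Q v)
  all-vertices? Q? = map′ (λ ∀Q (r , j) → ∀Q r j) (λ ∀Q r j → ∀Q (r , j)) (all? λ r → all? λ j → Q? (r , j))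
  MonochromaticBetweenFree : Vertex → Vertex → Vertex → Set
  MonochromaticBetweenFree x y z = tile₁₂ x ≡ tile₁₂ y → tile₁₂ y ≡ tile₁₂ z →
    ¬ x ≡ y → ¬ x ≡ z → ¬ y ≡ z → ¬ Between (gridMetric 3 12) x y z
  monochromatic-betweenFree : ∀ x y z → MonochromaticBetweenFree x y z
  monochromatic-betweenFree = toWitness {a? = all-vertices? λ x → all-vertices? λ y → all-vertices? λ z →
    (tile₁₂ x ≟ tile₁₂ y) →-dec (tile₁₂ y ≟ tile₁₂ z) →-dec ¬? (x ≟ᵥ y) →-dec ¬? (x ≟ᵥ z) →-dec ¬? (y ≟ᵥ z)
      →-dec ¬? (between? (gridMetric 3 12) x y z)} _

chiGP≤colours : ∀ {G k K} → ChiGP≡ G k → (c : V G → Fin K) → IsGPColouring G K c → k ≤ K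
chiGP≤colours (_ , minimal) c gp = ≮⇒≥ λ K<k → minimal _ K<k c gp

chiGP-P₃□P-lower : ∀ {n k} → ChiGP≡ (P 3 □ P n) k → 5 * n ≤ 6 * k
chiGP-P₃□P-lower {k = k} ((c , gp) , _) =
  ≤-trans (gpColouring⇒weight≤ rowWeight₃ c weight≤6 gp) (≤-reflexive (*-comm k 6))

chiGP-P₃□P-tiled : ∀ {n b k} → n ≤ b * 12 → ChiGP≡ (P 3 □ P n) k → 6 * k ≤ 5 * (b * 12)
chiGP-P₃□P-tiled {b = b} n≤b*12 χ =
  ≤-trans (*-monoʳ-≤ 6 (chiGP≤colours χ _ (Tiling.tiledColouring-gp tile₁₂ tile₁₂-gp {b = b} n≤b*12)))
          (≤-reflexive (sixty b))
  where
  sixty : ∀ b → 6 * (b * 10) ≡ 5 * (b * 12)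
  sixty = solve-∀

chiGP-P₃□P-upper : ∀ {n k} → ChiGP≡ (P 3 □ P n) k → 6 * k ≤ 5 * n + 60
chiGP-P₃□P-upper {n} {k} χ = begin
  6 * k                   ≤⟨ chiGP-P₃□P-tiled {b = suc q} n≤[1+q]*12 χ ⟩
  5 * (suc q * 12)        ≡⟨ one-more-block q ⟩
  5 * (q * 12) + 60       ≤⟨ +-monoˡ-≤ 60 (*-monoʳ-≤ 5 (m/n*n≤m n 12)) ⟩
  5 * n + 60              ∎
  where
  open ≤-Reasoning
  q = n / 12
  n≤[1+q]*12 : n ≤ suc q * 12
  n≤[1+q]*12 = ≤-trans (≤-reflexive (m≡m%n+[m/n]*n n 12)) (+-monoˡ-≤ _ (<⇒≤ (m%n<n n 12)))
  one-more-block : ∀ q → 5 * (suc q * 12) ≡ 5 * (q * 12) + 60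
  one-more-block = solve-∀

mainTheorem16 :
    (Σ ℕ λ C → ∀ n → 1 ≤ n → ∀ k → ChiGP≡ (P 3 □ P n) k →
        ∣ 6 * k - 5 * n ∣ ≤ 6 * C)
    × (∀ n → 1 ≤ n → 12 ∣ n → ∀ k → ChiGP≡ (P 3 □ P n) k → 6 * k ≡ 5 * n)
mainTheorem16 = (10 , deviation) , exact
  where
  -- Both bounds also hold for n = 0.
  deviation : ∀ n → 1 ≤ n → ∀ k → ChiGP≡ (P 3 □ P n) k → ∣ 6 * k - 5 * n ∣ ≤ 6 * 10
  deviation n _ k χ = begin
    ∣ 6 * k - 5 * n ∣  ≡⟨ m≤n⇒∣n-m∣≡n∸m (chiGP-P₃□P-lower χ) ⟩
    6 * k ∸ 5 * n      ≤⟨ m≤n+o⇒m∸n≤o (6 * k) (5 * n) (chiGP-P₃□P-upper χ) ⟩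
    60                 ∎
    where open ≤-Reasoning
  exact : ∀ n → 1 ≤ n → 12 ∣ n → ∀ k → ChiGP≡ (P 3 □ P n) k → 6 * k ≡ 5 * n
  exact _ _ (divides b refl) k χ = ≤-antisym (chiGP-P₃□P-tiled {b = b} ≤-refl χ) (chiGP-P₃□P-lower χ)
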